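{- Let $W\ge 1$ be an integer and $0<\varepsilon<1$ be such that $W\varepsilon^{ -1}=2^L$ for an integer $L$. Consider a window consisting of the last $W$ items of a stream over a universe of IDs, let $D$ be the number of distinct IDs in the window, and let $h$ be a random fingerprint function mapping IDs to $\{0,1,\dots,2^L-1\}$ such that the fingerprints of distinct IDs are independent and uniformly distributed. Let $Z$ be the number of distinct fingerprints among the items of the window, i.e. $Z=|\{h(y): y \text{ appears in the window}\}|$. Then $Z\le D$ always, and $\mathbb{E}(Z)\ge D\cdot\left(1-\frac{\varepsilon}{2}\right)$.
   Context: $Z$ is the quantity returned by the DistinctLB query of the SWAMP algorithm. -}

module Defs where

open import Data.Nat using (ℕ; zero; suc; _+_; _*_; _^_)
open import Data.Fin using (Fin)
open import Data.Fin.Properties using (_≟_)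
open import Data.List using (List; []; _∷_; length; map; deduplicate; allFin; concatMap)
open import Data.Nat.ListAction using (sum)
open import Data.Vec using (Vec; []; _∷_; lookup; toList)

-- All fingerprint functions h : Fin U → Fin M, each represented by its
-- table of values (a Vec (Fin M) U).  There are exactly M ^ U of them,
-- each listed once; the uniform distribution on this list is exactly the
-- law of a fully independent, uniform random fingerprint function.
allFuns : (U M : ℕ) → List (Vec (Fin M) U)
allFuns zero    M = [] ∷ []
allFuns (suc U) M = concatMap (λ v → map (λ i → i ∷ v) (allFin M)) (allFuns U M)

distinctCount : {U : ℕ} → List (Fin U) → ℕ
distinctCount xs = length (deduplicate _≟_ xs)

D : {U W : ℕ} → Vec (Fin U) W → ℕ
D window = distinctCount (toList window)

Z : {U W M : ℕ} → Vec (Fin M) U → Vec (Fin U) W → ℕ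
Z h window = distinctCount (map (lookup h) (toList window))

-- Sum of Z over all fingerprint functions; E(Z) = sumZ / M ^ U.
sumZ : (U M : ℕ) {W : ℕ} → Vec (Fin U) W → ℕ
sumZ U M window = sum (map (λ h → Z h window) (allFuns U M))

{-# OPTIONS --safe #-}

-- Write T_U(xs) for the total, over all M ^ U fingerprint functions h on the universe Fin U, of the number
-- of distinct values of h on the list xs, so that E(Z) = T_U / M ^ U.  Split h into its value i at ID 0 and
-- its restriction v to the other IDs: the image of xs under h is the image of the remaining IDs under v,
-- plus i when 0 occurs in xs and i is not already hit.  Summing over i gives the recurrence
-- T_{U+1}(xs) + p T_U(xs') = M (T_U(xs') + p M ^ U), where p = [0 ∈ xs] and xs' lists the other IDs of xs
-- shifted down by one.  Induction on U along it proves the birthday bound 2M T_U / M ^ U ≥ d (2M + 1 − d)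
-- for the number d of distinct IDs in xs.  Since d ≤ W this is E(Z) ≥ D (1 − ε/2).  That Z ≤ D holds because applying a function never adds distinct values.
module Submission where

open import Defs
open import Data.Nat using (ℕ; zero; suc; _+_; _*_; _^_; _∸_; _≤_; _<_; z≤n; s≤s)
open import Data.Nat.Properties
  using (+-*-semiring; +-identityʳ; *-identityˡ; *-identityʳ; *-comm; *-zeroʳ; +-cancelʳ-≡; +-cancelʳ-≤; +-mono-≤; +-monoˡ-≤;
         *-monoʳ-≤; *-monoˡ-≤; *-distribˡ-+; m≤m+n; m≤m*n; m≤n*m; m≤n⇒m≤1+n; <⇒≤; ≤-trans; ≤-reflexive; ∸-mono;
         m∸n+n≡m; module ≤-Reasoning)
open import Data.Nat.ListAction using (sum)
open import Data.Nat.ListAction.Properties using (sum-++)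
open import Data.Nat.Tactic.RingSolver using (solve-∀)
open import Data.Bool using (if_then_else_)
open import Data.Fin using (Fin; zero; suc)
open import Data.Fin.Properties using (_≟_; suc-injective)
open import Data.List using (List; []; _∷_; _++_; length; map; allFin; concatMap; tabulate; deduplicate)
open import Data.List.Properties using (map-++; map-cong; map-tabulate)
open import Data.List.Membership.Propositional using (_∈_; _∉_)
open import Data.List.Membership.Propositional.Properties using (∈-map⁺; ∈-map⁻; deduplicate-∈⇔)
import Data.List.Membership.DecPropositional as DecMembership
open import Data.List.Relation.Binary.Subset.Propositional using (_⊆_)
open import Data.List.Relation.Unary.Any using (here; there)
import Data.List.Relation.Unary.All as All
open import Data.List.Relation.Unary.Unique.Propositional using (Unique; []; _∷_)
open import Data.List.Relation.Unary.Unique.DecPropositional.Properties using (deduplicate-!)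
open import Data.Vec using (Vec; _∷_; lookup; toList)
open import Data.Vec.Properties using (length-toList)
open import Data.Product using (_×_; _,_)
open import Data.Sum using (_⊎_; inj₁; inj₂)
open import Relation.Nullary using (Dec; yes; no; does; ¬_; ¬?; contradiction)
open import Relation.Binary.PropositionalEquality
open import Function.Base using (id; _∘_)
open import Function.Bundles using (Equivalence)

open import Algebra.Properties.Semiring.Sum +-*-semiring using (sum-syntax; sum-cong-≗; sum-replicate-zero; ∑-distrib-+; *-distribˡ-sum)

⟦_⟧ : ∀ {a} {A : Set a} → Dec A → ℕ
⟦ a? ⟧ = if does a? then 1 else 0

⟦⟧-yes : ∀ {a} {A : Set a} → A → (a? : Dec A) → ⟦ a? ⟧ ≡ 1
⟦⟧-yes a (yes _) = refl
⟦⟧-yes a (no ¬a) = contradiction a ¬a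

⟦⟧-no : ∀ {a} {A : Set a} → ¬ A → (a? : Dec A) → ⟦ a? ⟧ ≡ 0
⟦⟧-no ¬a (yes a) = contradiction a ¬a
⟦⟧-no ¬a (no _) = refl

⟦⟧-cong : ∀ {a b} {A : Set a} {B : Set b} → (A → B) → (B → A) → (a? : Dec A) (b? : Dec B) → ⟦ a? ⟧ ≡ ⟦ b? ⟧
⟦⟧-cong f g (yes a) b? = sym (⟦⟧-yes (f a) b?)
⟦⟧-cong f g (no ¬a) b? = sym (⟦⟧-no (λ b → ¬a (g b)) b?)

⟦¬?⟧+⟦⟧≡1 : ∀ {a} {A : Set a} (a? : Dec A) → ⟦ ¬? a? ⟧ + ⟦ a? ⟧ ≡ 1
⟦¬?⟧+⟦⟧≡1 (yes _) = refl
⟦¬?⟧+⟦⟧≡1 (no _) = refl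

∑-const : ∀ n c → ∑[ i < n ] c ≡ n * c
∑-const zero c = refl
∑-const (suc n) c = cong (c +_) (∑-const n c)

∑-pick : ∀ {n} (i : Fin n) (f : Fin n → ℕ) → ∑[ j < n ] (⟦ j ≟ i ⟧ * f j) ≡ f i
∑-pick {suc n} zero f = begin
    f zero + 0 + ∑[ j < n ] (⟦ suc j ≟ zero ⟧ * f (suc j))
      ≡⟨ cong₂ _+_ (+-identityʳ (f zero)) (sum-cong-≗ λ j → cong (_* f (suc j)) (⟦⟧-no (λ ()) (suc j ≟ zero))) ⟩
    f zero + ∑[ j < n ] 0
      ≡⟨ cong (f zero +_) (sum-replicate-zero n) ⟩
    f zero + 0
      ≡⟨ +-identityʳ (f zero) ⟩
    f zero ∎
  where open ≡-Reasoning
∑-pick {suc n} (suc i) f = begin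
    ⟦ zero ≟ suc i ⟧ * f zero + ∑[ j < n ] (⟦ suc j ≟ suc i ⟧ * f (suc j))
      ≡⟨ cong₂ _+_ (cong (_* f zero) (⟦⟧-no (λ ()) (zero ≟ suc i)))
                   (sum-cong-≗ λ j → cong (_* f (suc j)) (⟦⟧-cong suc-injective (cong suc) (suc j ≟ suc i) (j ≟ i))) ⟩
    ∑[ j < n ] (⟦ j ≟ i ⟧ * f (suc j))
      ≡⟨ ∑-pick i (λ j → f (suc j)) ⟩
    f (suc i) ∎
  where open ≡-Reasoning

module _ {A : Set} where

  sum-map-+ : ∀ (f g : A → ℕ) xs → sum (map (λ x → f x + g x) xs) ≡ sum (map f xs) + sum (map g xs)
  sum-map-+ f g [] = refl
  sum-map-+ f g (x ∷ xs) = trans (cong (f x + g x +_) (sum-map-+ f g xs)) (interchange (f x) (g x) _ _)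
    where
    interchange : ∀ a b c d → a + b + (c + d) ≡ a + c + (b + d)
    interchange = solve-∀

  sum-map-*ˡ : ∀ c (f : A → ℕ) xs → sum (map (λ x → c * f x) xs) ≡ c * sum (map f xs)
  sum-map-*ˡ c f [] = sym (*-zeroʳ c)
  sum-map-*ˡ c f (x ∷ xs) = trans (cong (c * f x +_) (sum-map-*ˡ c f xs)) (sym (*-distribˡ-+ c (f x) _))

  sum-map-const : ∀ c (xs : List A) → sum (map (λ _ → c) xs) ≡ length xs * c
  sum-map-const c [] = refl
  sum-map-const c (x ∷ xs) = cong (c +_) (sum-map-const c xs)

  sum-map-concatMap : ∀ {B : Set} (f : B → ℕ) (k : A → List B) xs →
                      sum (map f (concatMap k xs)) ≡ sum (map (λ x → sum (map f (k x))) xs)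
  sum-map-concatMap f k [] = refl
  sum-map-concatMap f k (x ∷ xs) = begin
      sum (map f (k x ++ concatMap k xs))               ≡⟨ cong sum (map-++ f (k x) (concatMap k xs)) ⟩
      sum (map f (k x) ++ map f (concatMap k xs))       ≡⟨ sum-++ (map f (k x)) (map f (concatMap k xs)) ⟩
      sum (map f (k x)) + sum (map f (concatMap k xs))  ≡⟨ cong (sum (map f (k x)) +_) (sum-map-concatMap f k xs) ⟩
      sum (map f (k x)) + sum (map (λ x → sum (map f (k x))) xs) ∎
    where open ≡-Reasoning

  sum-map-tabulate : ∀ {n} (f : A → ℕ) (g : Fin n → A) → sum (map f (tabulate g)) ≡ ∑[ i < n ] f (g i)
  sum-map-tabulate {zero} f g = refl
  sum-map-tabulate {suc n} f g = cong (f (g zero) +_) (sum-map-tabulate f (λ i → g (suc i)))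

_∈?_ : ∀ {n} (x : Fin n) (xs : List (Fin n)) → Dec (x ∈ xs)
_∈?_ = DecMembership._∈?_ _≟_

-- Distinct entries counted over the universe, which makes the counting linear in indicators.
card : ∀ {n} → List (Fin n) → ℕ
card {n} xs = ∑[ j < n ] ⟦ j ∈? xs ⟧

card-[] : ∀ {n} → card {n} [] ≡ 0
card-[] {n} = sum-replicate-zero n

card-cong : ∀ {n} {xs ys : List (Fin n)} → xs ⊆ ys → ys ⊆ xs → card xs ≡ card ys
card-cong {xs = xs} {ys} xs⊆ys ys⊆xs = sum-cong-≗ λ j → ⟦⟧-cong xs⊆ys ys⊆xs (j ∈? xs) (j ∈? ys)

card-∷ : ∀ {n} (x : Fin n) (xs : List (Fin n)) → card (x ∷ xs) ≡ ⟦ ¬? (x ∈? xs) ⟧ + card xs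
card-∷ {n} x xs = begin
    ∑[ j < n ] ⟦ j ∈? (x ∷ xs) ⟧
      ≡⟨ sum-cong-≗ ⟦∈?∷⟧ ⟩
    ∑[ j < n ] (⟦ j ≟ x ⟧ * ⟦ ¬? (x ∈? xs) ⟧ + ⟦ j ∈? xs ⟧)
      ≡⟨ ∑-distrib-+ (λ j → ⟦ j ≟ x ⟧ * ⟦ ¬? (x ∈? xs) ⟧) (λ j → ⟦ j ∈? xs ⟧) ⟩
    ∑[ j < n ] (⟦ j ≟ x ⟧ * ⟦ ¬? (x ∈? xs) ⟧) + card xs
      ≡⟨ cong (_+ card xs) (∑-pick x (λ _ → ⟦ ¬? (x ∈? xs) ⟧)) ⟩
    ⟦ ¬? (x ∈? xs) ⟧ + card xs ∎
  where
  open ≡-Reasoning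
  ⟦∈?∷⟧ : ∀ j → ⟦ j ∈? (x ∷ xs) ⟧ ≡ ⟦ j ≟ x ⟧ * ⟦ ¬? (x ∈? xs) ⟧ + ⟦ j ∈? xs ⟧
  ⟦∈?∷⟧ j with j ≟ x
  ... | no _ = refl
  ... | yes refl with j ∈? xs
  ...   | yes _ = refl
  ...   | no _ = refl

card≤length : ∀ {n} (xs : List (Fin n)) → card xs ≤ length xs
card≤length {n} [] = ≤-reflexive (card-[] {n})
card≤length (x ∷ xs) rewrite card-∷ x xs with x ∈? xs
... | yes _ = m≤n⇒m≤1+n (card≤length xs)
... | no _ = s≤s (card≤length xs)

length≡card : ∀ {n} {xs : List (Fin n)} → Unique xs → length xs ≡ card xs
length≡card {n} [] = sym (card-[] {n})
length≡card {xs = x ∷ xs} (x∉xs ∷ unique) = begin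
    suc (length xs)                ≡⟨ cong₂ _+_ (sym (⟦⟧-yes x∉xs′ (¬? (x ∈? xs)))) (length≡card unique) ⟩
    ⟦ ¬? (x ∈? xs) ⟧ + card xs     ≡⟨ card-∷ x xs ⟨
    card (x ∷ xs)                  ∎
  where
  open ≡-Reasoning
  x∉xs′ : x ∉ xs
  x∉xs′ x∈xs = All.lookup x∉xs x∈xs refl

distinctCount≡card : ∀ {n} (xs : List (Fin n)) → distinctCount xs ≡ card xs
distinctCount≡card xs = trans (length≡card (deduplicate-! _≟_ xs))
  (card-cong (Equivalence.from (deduplicate-∈⇔ _≟_ {xs})) (Equivalence.to (deduplicate-∈⇔ _≟_ {xs})))

card-map-≤ : ∀ {n m} (f : Fin n → Fin m) (xs : List (Fin n)) → card (map f xs) ≤ card xs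
card-map-≤ {n} {m} f [] = ≤-reflexive (trans (card-[] {m}) (sym (card-[] {n})))
card-map-≤ f (x ∷ xs) rewrite card-∷ (f x) (map f xs) | card-∷ x xs with f x ∈? map f xs | x ∈? xs
... | yes _ | yes _ = card-map-≤ f xs
... | yes _ | no _ = m≤n⇒m≤1+n (card-map-≤ f xs)
... | no fx∉ | yes x∈ = contradiction (∈-map⁺ f x∈) fx∉
... | no _ | no _ = s≤s (card-map-≤ f xs)

shiftDown : ∀ {n} → List (Fin (suc n)) → List (Fin n)
shiftDown [] = []
shiftDown (zero ∷ xs) = shiftDown xs
shiftDown (suc j ∷ xs) = j ∷ shiftDown xs

∈-shiftDown⁺ : ∀ {n} {j : Fin n} {xs : List (Fin (suc n))} → suc j ∈ xs → j ∈ shiftDown xs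
∈-shiftDown⁺ {xs = zero ∷ xs} (there p) = ∈-shiftDown⁺ p
∈-shiftDown⁺ {xs = suc k ∷ xs} (here refl) = here refl
∈-shiftDown⁺ {xs = suc k ∷ xs} (there p) = there (∈-shiftDown⁺ p)

∈-shiftDown⁻ : ∀ {n} {j : Fin n} {xs : List (Fin (suc n))} → j ∈ shiftDown xs → suc j ∈ xs
∈-shiftDown⁻ {xs = zero ∷ xs} p = there (∈-shiftDown⁻ p)
∈-shiftDown⁻ {xs = suc k ∷ xs} (here refl) = here refl
∈-shiftDown⁻ {xs = suc k ∷ xs} (there p) = there (∈-shiftDown⁻ p)

card-shiftDown : ∀ {n} (xs : List (Fin (suc n))) → card xs ≡ ⟦ zero ∈? xs ⟧ + card (shiftDown xs)
card-shiftDown xs = cong (⟦ zero ∈? xs ⟧ +_) (sum-cong-≗ λ j →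
  ⟦⟧-cong ∈-shiftDown⁺ ∈-shiftDown⁻ (suc j ∈? xs) (j ∈? shiftDown xs))

card-complement : ∀ {n} (xs : List (Fin n)) → ∑[ j < n ] ⟦ ¬? (j ∈? xs) ⟧ + card xs ≡ n
card-complement {n} xs = begin
    ∑[ j < n ] ⟦ ¬? (j ∈? xs) ⟧ + card xs       ≡⟨ ∑-distrib-+ (λ j → ⟦ ¬? (j ∈? xs) ⟧) (λ j → ⟦ j ∈? xs ⟧) ⟨
    ∑[ j < n ] (⟦ ¬? (j ∈? xs) ⟧ + ⟦ j ∈? xs ⟧) ≡⟨ sum-cong-≗ (λ j → ⟦¬?⟧+⟦⟧≡1 (j ∈? xs)) ⟩
    ∑[ j < n ] 1                                 ≡⟨ ∑-const n 1 ⟩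
    n * 1                                        ≡⟨ *-identityʳ n ⟩
    n                                            ∎
  where open ≡-Reasoning

module _ {U M : ℕ} (v : Vec (Fin M) U) (xs : List (Fin (suc U))) where

  tailImage : List (Fin M)
  tailImage = map (lookup v) (shiftDown xs)

  ∈-image-∷⁻ : ∀ {i c} → c ∈ map (lookup (i ∷ v)) xs → (zero ∈ xs × c ≡ i) ⊎ c ∈ tailImage
  ∈-image-∷⁻ c∈ with ∈-map⁻ _ c∈
  ... | zero , 0∈xs , refl = inj₁ (0∈xs , refl)
  ... | suc j , j+1∈xs , refl = inj₂ (∈-map⁺ (lookup v) (∈-shiftDown⁺ j+1∈xs))

  tailImage⊆image-∷ : ∀ {i} → tailImage ⊆ map (lookup (i ∷ v)) xs
  tailImage⊆image-∷ {i} c∈ with ∈-map⁻ (lookup v) c∈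
  ... | j , j∈ , refl = ∈-map⁺ (lookup (i ∷ v)) (∈-shiftDown⁻ j∈)

  card-image-∷ : ∀ i → card (map (lookup (i ∷ v)) xs) ≡ ⟦ zero ∈? xs ⟧ * ⟦ ¬? (i ∈? tailImage) ⟧ + card tailImage
  card-image-∷ i with zero ∈? xs
  ... | yes 0∈xs = begin
      card (map (lookup (i ∷ v)) xs)               ≡⟨ card-cong image⊆i∷tailImage i∷tailImage⊆image ⟩
      card (i ∷ tailImage)                         ≡⟨ card-∷ i tailImage ⟩
      ⟦ ¬? (i ∈? tailImage) ⟧ + card tailImage     ≡⟨ cong (_+ card tailImage) (*-identityˡ _) ⟨
      1 * ⟦ ¬? (i ∈? tailImage) ⟧ + card tailImage ∎
    where
    open ≡-Reasoning
    image⊆i∷tailImage : map (lookup (i ∷ v)) xs ⊆ i ∷ tailImage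
    image⊆i∷tailImage c∈ with ∈-image-∷⁻ c∈
    ... | inj₁ (_ , refl) = here refl
    ... | inj₂ c∈tailImage = there c∈tailImage
    i∷tailImage⊆image : i ∷ tailImage ⊆ map (lookup (i ∷ v)) xs
    i∷tailImage⊆image (here refl) = ∈-map⁺ (lookup (i ∷ v)) 0∈xs
    i∷tailImage⊆image (there c∈tailImage) = tailImage⊆image-∷ c∈tailImage
  ... | no 0∉xs = card-cong image⊆tailImage tailImage⊆image-∷
    where
    image⊆tailImage : map (lookup (i ∷ v)) xs ⊆ tailImage
    image⊆tailImage c∈ with ∈-image-∷⁻ c∈
    ... | inj₁ (0∈xs , _) = contradiction 0∈xs 0∉xs
    ... | inj₂ c∈tailImage = c∈tailImage

  ∑-card-image-∷ : ∑[ i < M ] card (map (lookup (i ∷ v)) xs) + ⟦ zero ∈? xs ⟧ * card tailImage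
                     ≡ M * (card tailImage + ⟦ zero ∈? xs ⟧)
  ∑-card-image-∷ = begin
      ∑[ i < M ] card (map (lookup (i ∷ v)) xs) + p * card tailImage
        ≡⟨ cong (_+ p * card tailImage) (trans (sum-cong-≗ card-image-∷) (∑-distrib-+ (λ i → p * new i) (λ _ → card tailImage))) ⟩
      ∑[ i < M ] (p * new i) + ∑[ i < M ] card tailImage + p * card tailImage
        ≡⟨ cong₂ (λ a b → a + b + p * card tailImage) (*-distribˡ-sum p new) (sym (∑-const M (card tailImage))) ⟨
      p * ∑[ i < M ] new i + M * card tailImage + p * card tailImage
        ≡⟨ regroup p (∑[ i < M ] new i) M (card tailImage) ⟩
      M * card tailImage + p * (∑[ i < M ] new i + card tailImage)
        ≡⟨ cong (λ k → M * card tailImage + p * k) (card-complement tailImage) ⟩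
      M * card tailImage + p * M
        ≡⟨ collect M (card tailImage) p ⟩
      M * (card tailImage + p) ∎
    where
    open ≡-Reasoning
    p = ⟦ zero ∈? xs ⟧
    new : Fin M → ℕ
    new i = ⟦ ¬? (i ∈? tailImage) ⟧
    regroup : ∀ p n M c → p * n + M * c + p * c ≡ M * c + p * (n + c)
    regroup = solve-∀
    collect : ∀ M c p → M * c + p * M ≡ M * (c + p)
    collect = solve-∀

sum-allFuns-suc : ∀ U M (f : Vec (Fin M) (suc U) → ℕ) →
                  sum (map f (allFuns (suc U) M)) ≡ sum (map (λ v → ∑[ i < M ] f (i ∷ v)) (allFuns U M))
sum-allFuns-suc U M f = trans (sum-map-concatMap f _ (allFuns U M)) (cong sum (map-cong sum-over-heads (allFuns U M)))
  where
  sum-over-heads : ∀ v → sum (map f (map (_∷ v) (allFin M))) ≡ ∑[ i < M ] f (i ∷ v)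
  sum-over-heads v = trans (cong (sum ∘ map f) (map-tabulate id (_∷ v))) (sum-map-tabulate f (_∷ v))

length-allFuns : ∀ U M → length (allFuns U M) ≡ M ^ U
length-allFuns zero M = refl
length-allFuns (suc U) M = begin
    length (allFuns (suc U) M)                              ≡⟨ counting (allFuns (suc U) M) ⟩
    sum (map (λ _ → 1) (allFuns (suc U) M))                 ≡⟨ sum-allFuns-suc U M (λ _ → 1) ⟩
    sum (map (λ _ → ∑[ i < M ] 1) (allFuns U M))            ≡⟨ sum-map-const (∑[ i < M ] 1) (allFuns U M) ⟩
    length (allFuns U M) * ∑[ i < M ] 1                     ≡⟨ cong₂ _*_ (length-allFuns U M) (trans (∑-const M 1) (*-identityʳ M)) ⟩
    M ^ U * M                                               ≡⟨ *-comm (M ^ U) M ⟩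
    M ^ suc U ∎
  where
  open ≡-Reasoning
  counting : ∀ {A : Set} (xs : List A) → length xs ≡ sum (map (λ _ → 1) xs)
  counting xs = sym (trans (sum-map-const 1 xs) (*-identityʳ (length xs)))

sumCard : ∀ U M → List (Fin U) → ℕ
sumCard U M xs = sum (map (λ h → card (map (lookup h) xs)) (allFuns U M))

sumCard-suc : ∀ U M (xs : List (Fin (suc U))) →
  sumCard (suc U) M xs + ⟦ zero ∈? xs ⟧ * sumCard U M (shiftDown xs)
    ≡ M * (sumCard U M (shiftDown xs) + M ^ U * ⟦ zero ∈? xs ⟧)
sumCard-suc U M xs = begin
    sumCard (suc U) M xs + p * sum (map tailCard fs)
      ≡⟨ cong₂ _+_ (sum-allFuns-suc U M (λ h → card (map (lookup h) xs))) (sym (sum-map-*ˡ p tailCard fs)) ⟩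
    sum (map headSum fs) + sum (map (λ v → p * tailCard v) fs)
      ≡⟨ sum-map-+ headSum (λ v → p * tailCard v) fs ⟨
    sum (map (λ v → headSum v + p * tailCard v) fs)
      ≡⟨ cong sum (map-cong (λ v → ∑-card-image-∷ v xs) fs) ⟩
    sum (map (λ v → M * (tailCard v + p)) fs)
      ≡⟨ sum-map-*ˡ M (λ v → tailCard v + p) fs ⟩
    M * sum (map (λ v → tailCard v + p) fs)
      ≡⟨ cong (M *_) (sum-map-+ tailCard (λ _ → p) fs) ⟩
    M * (sum (map tailCard fs) + sum (map (λ _ → p) fs))
      ≡⟨ cong (λ k → M * (sum (map tailCard fs) + k)) (trans (sum-map-const p fs) (cong (_* p) (length-allFuns U M))) ⟩
    M * (sum (map tailCard fs) + M ^ U * p) ∎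
  where
  open ≡-Reasoning
  p = ⟦ zero ∈? xs ⟧
  fs = allFuns U M
  tailCard : Vec (Fin M) U → ℕ
  tailCard v = card (tailImage v xs)
  headSum : Vec (Fin M) U → ℕ
  headSum v = ∑[ i < M ] card (map (lookup (i ∷ v)) xs)

-- S / Q ≥ d (2M + 1 − d) / 2M = d − d (d − 1) / 2M, cleared of division and subtraction.
BirthdayBound : (M Q S d : ℕ) → Set
BirthdayBound M Q S d = d * (2 * M + 1) * Q ≤ 2 * M * S + d * d * Q

n≤n*n : ∀ n → n ≤ n * n
n≤n*n zero = z≤n
n≤n*n (suc n) = m≤m*n (suc n) (suc n)

birthdayBound-step : ∀ {M Q S T d a} {A : Set a} (a? : Dec A) →
  T + ⟦ a? ⟧ * S ≡ M * (S + Q * ⟦ a? ⟧) → BirthdayBound M Q S d → BirthdayBound M (M * Q) T (⟦ a? ⟧ + d)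
birthdayBound-step {M} {Q} {S} {T} {d} (no _) recurrence bound = begin
    d * (2 * M + 1) * (M * Q)        ≡⟨ pull-M M Q d ⟩
    M * (d * (2 * M + 1) * Q)        ≤⟨ *-monoʳ-≤ M bound ⟩
    M * (2 * M * S + d * d * Q)      ≡⟨ push-M M Q S d ⟩
    2 * M * (M * S) + d * d * (M * Q) ≡⟨ cong (λ t → 2 * M * t + d * d * (M * Q)) T≡M*S ⟨
    2 * M * T + d * d * (M * Q)      ∎
  where
  open ≤-Reasoning
  T≡M*S : T ≡ M * S
  T≡M*S = trans (sym (+-identityʳ T)) (trans recurrence (cong (M *_) (trans (cong (S +_) (*-zeroʳ Q)) (+-identityʳ S))))
  pull-M : ∀ M Q d → d * (2 * M + 1) * (M * Q) ≡ M * (d * (2 * M + 1) * Q)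
  pull-M = solve-∀
  push-M : ∀ M Q S d → M * (2 * M * S + d * d * Q) ≡ 2 * M * (M * S) + d * d * (M * Q)
  push-M = solve-∀
birthdayBound-step {zero} {Q} {d = d} (yes _) _ _ = ≤-trans (≤-reflexive (*-zeroʳ (suc d * 1))) z≤n
-- m = M − 1 times the hypothesis for the shifted list, together with d ≤ d * d.
birthdayBound-step {suc m} {Q} {S} {T} {d} (yes _) recurrence bound = begin
    suc d * (2 * M + 1) * (M * Q)                     ≡⟨ split-lhs m Q d ⟩
    m * (d * (2 * M + 1) * Q) + d * Q + C             ≤⟨ +-monoˡ-≤ C (+-mono-≤ (*-monoʳ-≤ m bound) (*-monoˡ-≤ Q (n≤n*n d))) ⟩
    m * (2 * M * S + d * d * Q) + d * d * Q + C       ≡⟨ merge-rhs m Q S d ⟩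
    2 * M * (m * S + M * Q) + suc d * suc d * (M * Q) ≡⟨ cong (λ t → 2 * M * t + suc d * suc d * (M * Q)) T≡mS+MQ ⟨
    2 * M * T + suc d * suc d * (M * Q)               ∎
  where
  open ≤-Reasoning
  M = suc m
  C = (2 * M + 1) * (M * Q) + 2 * M * Q * d
  T≡mS+MQ : T ≡ m * S + M * Q
  T≡mS+MQ = +-cancelʳ-≡ S T (m * S + M * Q) (trans (cong (T +_) (sym (+-identityʳ S))) (trans recurrence (expand m Q S)))
    where
    expand : ∀ m Q S → suc m * (S + Q * 1) ≡ m * S + suc m * Q + S
    expand = solve-∀
  split-lhs : ∀ m Q d → suc d * (2 * suc m + 1) * (suc m * Q)
    ≡ m * (d * (2 * suc m + 1) * Q) + d * Q + ((2 * suc m + 1) * (suc m * Q) + 2 * suc m * Q * d)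
  split-lhs = solve-∀
  merge-rhs : ∀ m Q S d → m * (2 * suc m * S + d * d * Q) + d * d * Q + ((2 * suc m + 1) * (suc m * Q) + 2 * suc m * Q * d)
    ≡ 2 * suc m * (m * S + suc m * Q) + suc d * suc d * (suc m * Q)
  merge-rhs = solve-∀

birthdayBound : ∀ M U (xs : List (Fin U)) → BirthdayBound M (M ^ U) (sumCard U M xs) (card xs)
birthdayBound M zero xs = z≤n
birthdayBound M (suc U) xs =
  subst (BirthdayBound M (M ^ suc U) (sumCard (suc U) M xs)) (sym (card-shiftDown xs))
        (birthdayBound-step {M} (zero ∈? xs) (sumCard-suc U M xs) (birthdayBound M U (shiftDown xs)))

birthdayBound⇒ : ∀ {M Q S d W} → BirthdayBound M Q S d → d ≤ W → W ≤ 2 * M → d * (2 * M ∸ W) * Q ≤ 2 * M * S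
birthdayBound⇒ {M} {Q} {S} {d} {W} bound d≤W W≤2M = +-cancelʳ-≤ (d * d * Q) (d * (2 * M ∸ W) * Q) (2 * M * S) (begin
    d * (2 * M ∸ W) * Q + d * d * Q      ≤⟨ +-monoˡ-≤ (d * d * Q) (*-monoˡ-≤ Q (*-monoʳ-≤ d (∸-mono (m≤m+n (2 * M) 1) d≤W))) ⟩
    d * (2 * M + 1 ∸ d) * Q + d * d * Q  ≡⟨ factor d (2 * M + 1 ∸ d) Q ⟩
    d * (2 * M + 1 ∸ d + d) * Q          ≡⟨ cong (λ k → d * k * Q) (m∸n+n≡m d≤2M+1) ⟩
    d * (2 * M + 1) * Q                  ≤⟨ bound ⟩
    2 * M * S + d * d * Q                ∎)
  where
  open ≤-Reasoning
  d≤2M+1 : d ≤ 2 * M + 1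
  d≤2M+1 = ≤-trans d≤W (≤-trans W≤2M (m≤m+n (2 * M) 1))
  factor : ∀ d e Q → d * e * Q + d * d * Q ≡ d * (e + d) * Q
  factor = solve-∀

theorem7 : (W L U : ℕ) (window : Vec (Fin U) W) → 1 ≤ W → W < 2 ^ L →
    ((h : Vec (Fin (2 ^ L)) U) → Z h window ≤ D window)
    × (D window * (2 * 2 ^ L ∸ W) * (2 ^ L) ^ U ≤ 2 * 2 ^ L * sumZ U (2 ^ L) window)
theorem7 W L U window _ W<2^L = Z≤D , mean-bound
  where
  xs = toList window
  Z≡card : ∀ h → Z h window ≡ card (map (lookup h) xs)
  Z≡card h = distinctCount≡card (map (lookup h) xs)
  Z≤D : (h : Vec (Fin (2 ^ L)) U) → Z h window ≤ D window
  Z≤D h = subst₂ _≤_ (sym (Z≡card h)) (sym (distinctCount≡card xs)) (card-map-≤ (lookup h) xs)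
  D≤W : card xs ≤ W
  D≤W = subst (card xs ≤_) (length-toList window) (card≤length xs)
  mean-bound : D window * (2 * 2 ^ L ∸ W) * (2 ^ L) ^ U ≤ 2 * 2 ^ L * sumZ U (2 ^ L) window
  mean-bound = subst₂ (λ d s → d * (2 * 2 ^ L ∸ W) * (2 ^ L) ^ U ≤ 2 * 2 ^ L * s)
    (sym (distinctCount≡card xs)) (cong sum (map-cong (λ h → sym (Z≡card h)) (allFuns U (2 ^ L))))
    (birthdayBound⇒ {2 ^ L} (birthdayBound (2 ^ L) U xs) D≤W (≤-trans (<⇒≤ W<2^L) (m≤n*m (2 ^ L) 2)))
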